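{- We have $n_2(3,1,1)=n_2(3,2,1)=6$, $n_2(3,3,1)=n_2(3,4,1)=8$, $n_2(3,5,1)=11$, $n_2(3,6,1)=12$, $n_2(3,7,1)=14$, and $n_2(3,d,1)=n_2(3,d)$ for all $d\ge 8$.
   Context: An $[n,k,d]_q$-code is a $k$-dimensional subspace of $\mathbb{F}_q^n$ with minimum Hamming distance at least $d$. $n_q(k,d)$ denotes the minimum length $n$ of an $[n,k,d]_q$-code. A linear code $C\subseteq\mathbb{F}_q^n$ has locality $r$ if for every coordinate $i$ there is a set $S_i\subseteq\{1,\dots,n\}\setminus\{i\}$ with $|S_i|\le r$ such that any two codewords agreeing on all coordinates in $S_i$ also agree in coordinate $i$. $n_q(k,d,r)$ denotes the minimum length $n$ of an $[n,k,d]_q$-code with locality $r$. -}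

module Defs where

open import Data.Nat using (ℕ; zero; suc; _+_; _≤_)
open import Data.Bool using (Bool; true; false; _xor_; _∧_; if_then_else_)
open import Data.Fin using (Fin; zero; suc)
open import Data.Fin.Subset using (Subset; _∈_; _∉_; ∣_∣)
open import Data.Product using (Σ; _×_; ∃)
open import Relation.Binary.PropositionalEquality using (_≡_; _≢_)
open import Relation.Nullary using (¬_)

-- The field F_2 is modelled by Bool with xor as addition and ∧ as multiplication.
-- A vector of F_2^n is a function Fin n → Bool.
Word : ℕ → Set
Word n = Fin n → Bool

sumℕ : {n : ℕ} → (Fin n → ℕ) → ℕ
sumℕ {zero} f = 0
sumℕ {suc n} f = f zero + sumℕ (λ i → f (suc i))

sumF₂ : {n : ℕ} → (Fin n → Bool) → Bool
sumF₂ {zero} f = false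
sumF₂ {suc n} f = f zero xor sumF₂ (λ i → f (suc i))

hamming : {n : ℕ} → Word n → Word n → ℕ
hamming x y = sumℕ (λ j → if x j xor y j then 1 else 0)

GenMatrix : ℕ → ℕ → Set
GenMatrix k n = Fin k → Word n

-- Encoding map F_2^k → F_2^n, m ↦ m G.  The code is the image of this map.
encode : {k n : ℕ} → GenMatrix k n → Word k → Word n
encode G m j = sumF₂ (λ i → m i ∧ G i j)

-- The code generated by G has dimension exactly k: the rows are linearly
-- independent, i.e. the encoding map is injective.
HasDimension : {k n : ℕ} → GenMatrix k n → Set
HasDimension {k} G = ∀ (m m' : Word k) → (∀ j → encode G m j ≡ encode G m' j) → ∀ i → m i ≡ m' i

MinDistanceAtLeast : {k n : ℕ} → GenMatrix k n → ℕ → Set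
MinDistanceAtLeast {k} G d = ∀ (m m' : Word k) →
  ¬ (∀ j → encode G m j ≡ encode G m' j) → d ≤ hamming (encode G m) (encode G m')

HasLocality : {k n : ℕ} → GenMatrix k n → ℕ → Set
HasLocality {k} {n} G r = ∀ (i : Fin n) → Σ (Subset n) λ S →
  (i ∉ S) × (∣ S ∣ ≤ r) ×
  (∀ (m m' : Word k) → (∀ j → j ∈ S → encode G m j ≡ encode G m' j) → encode G m i ≡ encode G m' i)

ExistsCode : ℕ → ℕ → ℕ → Set
ExistsCode n k d = Σ (GenMatrix k n) λ G → HasDimension G × MinDistanceAtLeast G d

ExistsLocalCode : ℕ → ℕ → ℕ → ℕ → Set
ExistsLocalCode n k d r = Σ (GenMatrix k n) λ G → HasDimension G × MinDistanceAtLeast G d × HasLocality G r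

IsMinimum : (ℕ → Set) → ℕ → Set
IsMinimum P n = P n × (∀ m → P m → n ≤ m)

n₂≡ : ℕ → ℕ → ℕ → Set
n₂≡ k d n = IsMinimum (λ len → ExistsCode len k d) n

n₂loc≡ : ℕ → ℕ → ℕ → ℕ → Set
n₂loc≡ k d r n = IsMinimum (λ len → ExistsLocalCode len k d r) n

{-# OPTIONS --safe #-}

-- A generator matrix of a three-dimensional binary code is determined, up to the order of its
-- columns, by the multiplicity m v with which each point v of F₂³ occurs as a column, and the
-- codeword of q ∈ F₂³ has weight Σ {m v ∣ q · v = 1}.  A coordinate can only be recovered from
-- a single other coordinate if the two columns are equal, so locality 1 means that no nonzero
-- column occurs exactly once.  For d ≤ 7 both bounds are checked by computer: an exhaustive search
-- over such multiplicities below the claimed length, and an explicit code of that length.  For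
-- d ≥ 8 every code satisfies the Griesmer bound d + ⌈d/2⌉ + ⌈d/4⌉, and codes in which every
-- nonzero column occurs at least twice attain it: four small ones for d = 8, …, 11, and appending
-- a simplex code raises d by 4 and the length by 7.
module Submission where

open import Defs
open import Data.Nat using (ℕ; _≤_)
open import Data.Product using (_×_)
open import Function.Bundles using (_⇔_)

open import Algebra.Bundles using (CommutativeRing)
open import Data.Nat
  using (zero; suc; _+_; _*_; _∸_; _<_; _≡ᵇ_; _≤?_; _≟_; z≤n; s≤s; ⌈_/2⌉)
open import Data.Nat.Properties
open import Data.Nat.ListAction using (sum)
open import Data.Nat.Tactic.RingSolver using (solve-∀)
open import Data.Fin as Fin using (Fin; zero; suc)
open import Data.Fin.Properties using () renaming (suc-injective to fsuc-injective)
open import Data.Fin.Subset using (Subset; _∉_; ∣_∣; ⁅_⁆) renaming (_∈_ to _∈ₛ_; ⊥ to ⊥ₛ)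
open import Data.Fin.Subset.Properties
  using (∉⊥; ∣⊥∣≡0; x∈⁅x⁆; x≢y⇒x∉⁅y⁆; ∣⁅x⁆∣≡1; x∈p∧x≢y⇒x∈p-y; x∈p⇒∣p-x∣<∣p∣; nonempty?)
open import Data.Bool using (Bool; true; false; not; _∧_; _∨_; _xor_; if_then_else_; T)
open import Data.Bool.Properties
  using (T-∧; ¬-not; ∧-zeroʳ; ∧-distribʳ-xor; xor-identityʳ; xor-same; xor-∧-commutativeRing)
  renaming (_≟_ to _≟ᵇ_)
open import Data.List as List using (List; []; _∷_; _++_; map; length; replicate; concatMap)
open import Data.List.Properties using (map-cong)
open import Data.List.Extrema.Nat using (argmin; argmin-all; f[argmin]≤f[xs])
open import Data.List.Membership.Propositional using (_∈_)
open import Data.List.Relation.Unary.All as All using (All; all?; _∷_; [])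
import Data.List.Relation.Unary.All.Properties as All
open import Data.List.Relation.Unary.Any using (here; there)
open import Data.Product using (Σ; ∃; _,_; proj₁; proj₂)
open import Data.Product.Properties using (≡-dec)
open import Data.Sum using (inj₁; inj₂)
open import Data.Empty using (⊥-elim)
open import Function using (_∘_; Equivalence; mk⇔)
open import Relation.Binary.Definitions using (DecidableEquality)
open import Relation.Binary.PropositionalEquality
open import Relation.Nullary using (yes; no; contradiction)
open import Relation.Nullary.Decidable using (Dec; True; from-yes; toWitness; ⌊_⌋; ¬?; _×-dec_)
open import Relation.Unary using (Decidable)
open import Algebra.Properties.CommutativeSemigroup
  (CommutativeRing.+-commutativeSemigroup xor-∧-commutativeRing) using (interchange)
open import Algebra.Properties.CommutativeSemigroup +-commutativeSemigroup
  using () renaming (interchange to +-interchange)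

Point : Set
Point = Bool × Bool × Bool

pattern p0 = false , false , false
pattern p1 = false , false , true
pattern p2 = false , true  , false
pattern p3 = false , true  , true
pattern p4 = true  , false , false
pattern p5 = true  , false , true
pattern p6 = true  , true  , false
pattern p7 = true  , true  , true

nonzeroPoints points : List Point
nonzeroPoints = p1 ∷ p2 ∷ p3 ∷ p4 ∷ p5 ∷ p6 ∷ p7 ∷ []
points = p0 ∷ nonzeroPoints

∈-nonzeroPoints : ∀ {v} → v ≢ p0 → v ∈ nonzeroPoints
∈-nonzeroPoints {p0} v≢0 = ⊥-elim (v≢0 refl)
∈-nonzeroPoints {p1} _ = here refl
∈-nonzeroPoints {p2} _ = there (here refl)
∈-nonzeroPoints {p3} _ = there (there (here refl))
∈-nonzeroPoints {p4} _ = there (there (there (here refl)))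
∈-nonzeroPoints {p5} _ = there (there (there (there (here refl))))
∈-nonzeroPoints {p6} _ = there (there (there (there (there (here refl)))))
∈-nonzeroPoints {p7} _ = there (there (there (there (there (there (here refl))))))

tabulate-nonzero : {P : Point → Set} → (∀ q → q ≢ p0 → P q) → All P nonzeroPoints
tabulate-nonzero h =
  h p1 (λ ()) ∷ h p2 (λ ()) ∷ h p3 (λ ()) ∷ h p4 (λ ()) ∷ h p5 (λ ()) ∷ h p6 (λ ()) ∷ h p7 (λ ()) ∷ []

lookup-nonzero : {P : Point → Set} → All P nonzeroPoints → ∀ {q} → q ≢ p0 → P q
lookup-nonzero ps q≢0 = All.lookup ps (∈-nonzeroPoints q≢0)

_≟ₚ_ : DecidableEquality Point
_≟ₚ_ = ≡-dec _≟ᵇ_ (≡-dec _≟ᵇ_ _≟ᵇ_)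

-- The trailing xor false makes encode G m j definitionally equal to message m · column G j.
_·_ : Point → Point → Bool
(a , b , c) · (x , y , z) = (a ∧ x) xor ((b ∧ y) xor ((c ∧ z) xor false))

_⊕_ : Point → Point → Point
(a , b , c) ⊕ (x , y , z) = (a xor x) , (b xor y) , (c xor z)

·-zeroʳ : ∀ q → q · p0 ≡ false
·-zeroʳ (a , b , c) rewrite ∧-zeroʳ a | ∧-zeroʳ b | ∧-zeroʳ c = refl

·-distribʳ-⊕ : ∀ p q v → (p ⊕ q) · v ≡ (p · v) xor (q · v)
·-distribʳ-⊕ (a , b , c) (a′ , b′ , c′) (x , y , z) = begin
  ((a xor a′) ∧ x) xor (((b xor b′) ∧ y) xor (((c xor c′) ∧ z) xor false))
    ≡⟨ cong₂ _xor_ (∧-distribʳ-xor x a a′) (cong₂ _xor_ (∧-distribʳ-xor y b b′)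
         (cong (_xor false) (∧-distribʳ-xor z c c′))) ⟩
  (A xor A′) xor ((B xor B′) xor ((C xor C′) xor (false xor false)))
    ≡⟨ cong (λ t → (A xor A′) xor ((B xor B′) xor t)) (interchange C C′ false false) ⟩
  (A xor A′) xor ((B xor B′) xor ((C xor false) xor (C′ xor false)))
    ≡⟨ cong ((A xor A′) xor_) (interchange B B′ (C xor false) (C′ xor false)) ⟩
  (A xor A′) xor ((B xor (C xor false)) xor (B′ xor (C′ xor false)))
    ≡⟨ interchange A A′ _ _ ⟩
  (A xor (B xor (C xor false))) xor (A′ xor (B′ xor (C′ xor false))) ∎
  where
  open ≡-Reasoning
  A = a ∧ x; A′ = a′ ∧ x; B = b ∧ y; B′ = b′ ∧ y; C = c ∧ z; C′ = c′ ∧ z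

xor≡false⇒≡ : ∀ a b → a xor b ≡ false → a ≡ b
xor≡false⇒≡ false false _ = refl
xor≡false⇒≡ true  true  _ = refl

⊕≡p0⇒≡ : ∀ p q → p ⊕ q ≡ p0 → p ≡ q
⊕≡p0⇒≡ (a , b , c) (x , y , z) eq =
  cong₂ _,_ (xor≡false⇒≡ a x (cong proj₁ eq))
    (cong₂ _,_ (xor≡false⇒≡ b y (cong (proj₁ ∘ proj₂) eq)) (xor≡false⇒≡ c z (cong (proj₂ ∘ proj₂) eq)))

⊕-identityʳ : ∀ q → q ⊕ p0 ≡ q
⊕-identityʳ (a , b , c) rewrite xor-identityʳ a | xor-identityʳ b | xor-identityʳ c = refl

coordinates : ∀ v → (p4 · v , p2 · v , p1 · v) ≡ v
coordinates (x , y , z) = cong₂ _,_ (xor-identityʳ x) (cong₂ _,_ (xor-identityʳ y) (xor-identityʳ z))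

coordinate-differs : ∀ {v u} → v ≢ u → ∃ λ e → e · v ≢ e · u
coordinate-differs {v} {u} v≢u with p4 · v ≟ᵇ p4 · u | p2 · v ≟ᵇ p2 · u | p1 · v ≟ᵇ p1 · u
... | no x≢ | _     | _     = p4 , x≢
... | yes _ | no y≢ | _     = p2 , y≢
... | yes _ | yes _ | no z≢ = p1 , z≢
... | yes x≡ | yes y≡ | yes z≡ = ⊥-elim (v≢u (begin
  v                          ≡⟨ sym (coordinates v) ⟩
  (p4 · v , p2 · v , p1 · v) ≡⟨ cong₂ _,_ x≡ (cong₂ _,_ y≡ z≡) ⟩
  (p4 · u , p2 · u , p1 · u) ≡⟨ coordinates u ⟩
  u                          ∎))
  where open ≡-Reasoning

Separates : Point → Point → Point → Set
Separates v u q = q · v ≡ true × q · u ≡ false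

separates-from : ∀ {v u} e f → e · v ≢ e · u → f · v ≡ true → ∃ (Separates v u)
separates-from {v} {u} e f ev≢eu fv with e · v in ev | e · u in eu | f · u in fu
... | true  | false | _     = e , ev , eu
... | false | true  | false = f , fv , fu
... | false | true  | true  = e ⊕ f , trans (·-distribʳ-⊕ e f v) (cong₂ _xor_ ev fv)
                                    , trans (·-distribʳ-⊕ e f u) (cong₂ _xor_ eu fu)
... | true  | true  | _     = ⊥-elim (ev≢eu refl)
... | false | false | _     = ⊥-elim (ev≢eu refl)

separating : ∀ v u → v ≢ p0 → v ≢ u → ∃ (Separates v u)
separating v u v≢0 v≢u with coordinate-differs v≢u | coordinate-differs v≢0
... | e , ev≢eu | f , fv≢f0 =
  separates-from e f ev≢eu (¬-not λ fv≡false → fv≢f0 (trans fv≡false (sym (·-zeroʳ f))))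

-- Column multiplicities and weights

sum-map-+ : ∀ {A : Set} (f g : A → ℕ) xs →
  sum (map (λ x → f x + g x) xs) ≡ sum (map f xs) + sum (map g xs)
sum-map-+ f g [] = refl
sum-map-+ f g (x ∷ xs) = begin
  (f x + g x) + sum (map (λ x → f x + g x) xs)    ≡⟨ cong (f x + g x +_) (sum-map-+ f g xs) ⟩
  (f x + g x) + (sum (map f xs) + sum (map g xs)) ≡⟨ +-interchange (f x) (g x) _ _ ⟩
  (f x + sum (map f xs)) + (g x + sum (map g xs)) ∎
  where open ≡-Reasoning

sum-map-mono-≤ : ∀ {A : Set} {f g : A → ℕ} → (∀ x → f x ≤ g x) → ∀ xs → sum (map f xs) ≤ sum (map g xs)
sum-map-mono-≤ f≤g [] = ≤-refl
sum-map-mono-≤ f≤g (x ∷ xs) = +-mono-≤ (f≤g x) (sum-map-mono-≤ f≤g xs)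

sum-map-cong : ∀ {A : Set} (f g : A → ℕ) → (∀ x → f x ≡ g x) → ∀ xs → sum (map f xs) ≡ sum (map g xs)
sum-map-cong f g f≗g xs = cong sum (map-cong f≗g xs)

Σₚ Σ⁺ : (Point → ℕ) → ℕ
Σₚ f = sum (map f points)
Σ⁺ f = sum (map f nonzeroPoints)

ind : Bool → ℕ
ind b = if b then 1 else 0

Σₚ-point : ∀ u (g : Point → ℕ) → Σₚ (λ v → ind ⌊ v ≟ₚ u ⌋ * g v) ≡ g u
Σₚ-point p0 g = trans (+-identityʳ _) (+-identityʳ _)
Σₚ-point p1 g = trans (+-identityʳ _) (+-identityʳ _)
Σₚ-point p2 g = trans (+-identityʳ _) (+-identityʳ _)
Σₚ-point p3 g = trans (+-identityʳ _) (+-identityʳ _)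
Σₚ-point p4 g = trans (+-identityʳ _) (+-identityʳ _)
Σₚ-point p5 g = trans (+-identityʳ _) (+-identityʳ _)
Σₚ-point p6 g = trans (+-identityʳ _) (+-identityʳ _)
Σₚ-point p7 g = trans (+-identityʳ _) (+-identityʳ _)

column : ∀ {n} → GenMatrix 3 n → Fin n → Point
column G j = G zero j , G (suc zero) j , G (suc (suc zero)) j

message : Word 3 → Point
message m = m zero , m (suc zero) , m (suc (suc zero))

word : Point → Word 3
word (a , b , c) zero = a
word (a , b , c) (suc zero) = b
word (a , b , c) (suc (suc zero)) = c

zeroWord : Word 3
zeroWord _ = false

count : ∀ {n} {P : Fin n → Set} → Decidable P → ℕ
count P? = sumℕ (λ j → ind ⌊ P? j ⌋)

multiplicity : ∀ {n} → GenMatrix 3 n → Point → ℕ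
multiplicity G v = count (λ j → v ≟ₚ column G j)

sumℕ-cong : ∀ {n} {f g : Fin n → ℕ} → (∀ j → f j ≡ g j) → sumℕ f ≡ sumℕ g
sumℕ-cong {zero} f≗g = refl
sumℕ-cong {suc n} f≗g = cong₂ _+_ (f≗g zero) (sumℕ-cong (f≗g ∘ suc))

sumℕ-const : ∀ n k → sumℕ {n} (λ _ → k) ≡ n * k
sumℕ-const zero k = refl
sumℕ-const (suc n) k = cong (k +_) (sumℕ-const n k)

dropColumn : ∀ {n} → GenMatrix 3 (suc n) → GenMatrix 3 n
dropColumn G i j = G i (suc j)

sumℕ-columns : ∀ {n} (G : GenMatrix 3 n) (g : Point → ℕ) →
  sumℕ (λ j → g (column G j)) ≡ Σₚ (λ v → multiplicity G v * g v)
sumℕ-columns {zero} G g = refl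
sumℕ-columns {suc n} G g = begin
  g c + sumℕ (λ j → g (column G′ j))
    ≡⟨ cong₂ _+_ (sym (Σₚ-point c g)) (sumℕ-columns G′ g) ⟩
  Σₚ (λ v → ind ⌊ v ≟ₚ c ⌋ * g v) + Σₚ (λ v → multiplicity G′ v * g v)
    ≡⟨ sym (sum-map-+ (λ v → ind ⌊ v ≟ₚ c ⌋ * g v) (λ v → multiplicity G′ v * g v) points) ⟩
  Σₚ (λ v → ind ⌊ v ≟ₚ c ⌋ * g v + multiplicity G′ v * g v)
    ≡⟨ sum-map-cong _ (λ v → multiplicity G v * g v)
         (λ v → sym (*-distribʳ-+ (g v) (ind ⌊ v ≟ₚ c ⌋) _)) points ⟩
  Σₚ (λ v → multiplicity G v * g v) ∎
  where
  open ≡-Reasoning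
  c = column G zero
  G′ = dropColumn G

length≡Σₚ-multiplicity : ∀ {n} (G : GenMatrix 3 n) → n ≡ Σₚ (multiplicity G)
length≡Σₚ-multiplicity {n} G = begin
  n                                  ≡⟨ sym (*-identityʳ n) ⟩
  n * 1                              ≡⟨ sym (sumℕ-const n 1) ⟩
  sumℕ {n} (λ j → 1)                 ≡⟨ sumℕ-columns G (λ _ → 1) ⟩
  Σₚ (λ v → multiplicity G v * 1)    ≡⟨ sum-map-cong _ (multiplicity G) (λ v → *-identityʳ _) points ⟩
  Σₚ (multiplicity G)                ∎
  where open ≡-Reasoning

weight : Point → (Point → ℕ) → ℕ
weight q m = Σ⁺ (λ v → if q · v then m v else 0)

weight-cong : ∀ q {m m′ : Point → ℕ} → (∀ v → m v ≡ m′ v) → weight q m ≡ weight q m′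
weight-cong q m≗m′ =
  sum-map-cong _ _ (λ v → cong (λ k → if q · v then k else 0) (m≗m′ v)) nonzeroPoints

weight-+ : ∀ q m m′ → weight q (λ v → m v + m′ v) ≡ weight q m + weight q m′
weight-+ q m m′ =
  trans (sum-map-cong _ (λ v → w m v + w m′ v) (λ v → if-+ (q · v)) nonzeroPoints)
        (sum-map-+ (w m) (w m′) nonzeroPoints)
  where
  w : (Point → ℕ) → Point → ℕ
  w m v = if q · v then m v else 0
  if-+ : ∀ {x y} b → (if b then x + y else 0) ≡ (if b then x else 0) + (if b then y else 0)
  if-+ true = refl
  if-+ false = refl

*-ind : ∀ k b → k * ind b ≡ (if b then k else 0)
*-ind k true = *-identityʳ k
*-ind k false = *-zeroʳ k

hamming-encode : ∀ {n} (G : GenMatrix 3 n) m m′ →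
  hamming (encode G m) (encode G m′) ≡ weight (message m ⊕ message m′) (multiplicity G)
hamming-encode G m m′ = begin
  sumℕ (λ j → ind ((message m · column G j) xor (message m′ · column G j)))
    ≡⟨ sumℕ-cong (λ j → cong ind (sym (·-distribʳ-⊕ (message m) (message m′) (column G j)))) ⟩
  sumℕ (λ j → ind (q · column G j))
    ≡⟨ sumℕ-columns G (λ v → ind (q · v)) ⟩
  multiplicity G p0 * ind (q · p0) + Σ⁺ (λ v → multiplicity G v * ind (q · v))
    ≡⟨ cong₂ _+_ (trans (cong (λ b → multiplicity G p0 * ind b) (·-zeroʳ q)) (*-zeroʳ (multiplicity G p0)))
                 (sum-map-cong _ (λ v → if q · v then multiplicity G v else 0)
                   (λ v → *-ind _ (q · v)) nonzeroPoints) ⟩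
  weight q (multiplicity G) ∎
  where
  open ≡-Reasoning
  q = message m ⊕ message m′

Distance : ℕ → (Point → ℕ) → Set
Distance d m = All (λ q → d ≤ weight q m) nonzeroPoints

distance? : ∀ d m → Dec (Distance d m)
distance? d m = all? (λ q → d ≤? weight q m) nonzeroPoints

message-cong : ∀ {m m′} → (∀ i → m i ≡ m′ i) → message m ≡ message m′
message-cong m≗m′ = cong₂ _,_ (m≗m′ zero) (cong₂ _,_ (m≗m′ (suc zero)) (m≗m′ (suc (suc zero))))

message-⊕≡p0 : ∀ m m′ → message m ⊕ message m′ ≡ p0 → ∀ i → m i ≡ m′ i
message-⊕≡p0 m m′ eq zero = cong proj₁ (⊕≡p0⇒≡ (message m) (message m′) eq)
message-⊕≡p0 m m′ eq (suc zero) = cong (proj₁ ∘ proj₂) (⊕≡p0⇒≡ (message m) (message m′) eq)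
message-⊕≡p0 m m′ eq (suc (suc zero)) = cong (proj₂ ∘ proj₂) (⊕≡p0⇒≡ (message m) (message m′) eq)

≗⇒hamming≡0 : ∀ {n} {x y : Word n} → (∀ j → x j ≡ y j) → hamming x y ≡ 0
≗⇒hamming≡0 {n} {x} {y} x≗y = begin
  sumℕ (λ j → ind (x j xor y j)) ≡⟨ sumℕ-cong (λ j → cong (λ b → ind (b xor y j)) (x≗y j)) ⟩
  sumℕ (λ j → ind (y j xor y j)) ≡⟨ sumℕ-cong (λ j → cong ind (xor-same (y j))) ⟩
  sumℕ {n} (λ j → 0)             ≡⟨ sumℕ-const n 0 ⟩
  n * 0                          ≡⟨ *-zeroʳ n ⟩
  0                              ∎
  where open ≡-Reasoning

code⇒distance : ∀ {n d} (G : GenMatrix 3 n) → HasDimension G → MinDistanceAtLeast G d →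
  Distance d (multiplicity G)
code⇒distance {d = d} G dim dist = tabulate-nonzero λ q q≢0 →
  subst (d ≤_) (trans (hamming-encode G (word q) zeroWord)
                       (cong (λ p → weight p (multiplicity G)) (⊕-identityʳ q)))
    (dist (word q) zeroWord (λ agree → q≢0 (message-cong (dim (word q) zeroWord agree))))

distance⇒code : ∀ {n d} (G : GenMatrix 3 n) → 1 ≤ d → Distance d (multiplicity G) →
  HasDimension G × MinDistanceAtLeast G d
distance⇒code {d = d} G 1≤d dist = dim , minDist
  where
  minDist : MinDistanceAtLeast G d
  minDist m m′ disagree with (message m ⊕ message m′) ≟ₚ p0
  ... | yes q≡0 = ⊥-elim (disagree λ j → cong (_· column G j) (message-cong (message-⊕≡p0 m m′ q≡0)))
  ... | no q≢0 = subst (d ≤_) (sym (hamming-encode G m m′)) (lookup-nonzero dist q≢0)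
  dim : HasDimension G
  dim m m′ agree with (message m ⊕ message m′) ≟ₚ p0
  ... | yes q≡0 = message-⊕≡p0 m m′ q≡0
  ... | no q≢0 = ⊥-elim (<⇒≱ 1≤d (subst (d ≤_) (trans (sym (hamming-encode G m m′)) (≗⇒hamming≡0 agree))
                                               (lookup-nonzero dist q≢0)))

-- Locality one

count≥1 : ∀ {n} {P : Fin n → Set} (P? : Decidable P) {i} → P i → 1 ≤ count P?
count≥1 P? {zero} Pi with P? zero
... | yes _ = s≤s z≤n
... | no ¬P0 = ⊥-elim (¬P0 Pi)
count≥1 P? {suc i} Pi = ≤-trans (count≥1 (P? ∘ suc) Pi) (m≤n+m _ _)

count≥2 : ∀ {n} {P : Fin n → Set} (P? : Decidable P) {i j} → i ≢ j → P i → P j → 2 ≤ count P?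
count≥2 P? {zero} {zero} i≢j _ _ = ⊥-elim (i≢j refl)
count≥2 P? {zero} {suc j} _ Pi Pj with P? zero
... | yes _ = s≤s (count≥1 (P? ∘ suc) Pj)
... | no ¬P0 = ⊥-elim (¬P0 Pi)
count≥2 P? {suc i} {zero} _ Pi Pj with P? zero
... | yes _ = s≤s (count≥1 (P? ∘ suc) Pi)
... | no ¬P0 = ⊥-elim (¬P0 Pj)
count≥2 P? {suc i} {suc j} i≢j Pi Pj = ≤-trans (count≥2 (P? ∘ suc) (i≢j ∘ cong suc) Pi Pj) (m≤n+m _ _)

count-pos : ∀ {n} {P : Fin n → Set} (P? : Decidable P) → count P? ≢ 0 → ∃ P
count-pos {zero} P? count≢0 = ⊥-elim (count≢0 refl)
count-pos {suc n} P? count≢0 with P? zero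
... | yes P0 = zero , P0
... | no _ = let j , Pj = count-pos (P? ∘ suc) count≢0 in suc j , Pj

count-other : ∀ {n} {P : Fin n → Set} (P? : Decidable P) {i} → P i → count P? ≢ 1 →
  ∃ λ j → j ≢ i × P j
count-other P? {zero} Pi count≢1 with P? zero
... | yes _ = let j , Pj = count-pos (P? ∘ suc) (count≢1 ∘ cong suc) in suc j , (λ ()) , Pj
... | no ¬P0 = ⊥-elim (¬P0 Pi)
count-other P? {suc i} Pi count≢1 with P? zero
... | yes P0 = zero , (λ ()) , P0
... | no _ = let j , j≢i , Pj = count-other (P? ∘ suc) Pi count≢1 in suc j , j≢i ∘ fsuc-injective , Pj

NoLoneColumns : (Point → ℕ) → Set
NoLoneColumns m = All (λ v → m v ≢ 1) nonzeroPoints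

noLoneColumns? : ∀ m → Dec (NoLoneColumns m)
noLoneColumns? m = all? (λ v → ¬? (m v ≟ 1)) nonzeroPoints

∣S∣≤1-unique : ∀ {n} {S : Subset n} {j k} → ∣ S ∣ ≤ 1 → j ∈ₛ S → k ∈ₛ S → k ≡ j
∣S∣≤1-unique {j = j} {k} ∣S∣≤1 j∈S k∈S with k Fin.≟ j
... | yes k≡j = k≡j
... | no k≢j = contradiction (≤-trans (s≤s (x∈p⇒∣p-x∣<∣p∣ (x∈p∧x≢y⇒x∈p-y k∈S k≢j)))
                                     (≤-trans (x∈p⇒∣p-x∣<∣p∣ j∈S) ∣S∣≤1)) λ { (s≤s ()) }

-- If S = ∅, or S = {j} with column j ≠ column i, a functional q separating column i from 0,
-- resp. from column j, gives two codewords that agree on S but differ at i.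
recoverable⇒twin : ∀ {n} (G : GenMatrix 3 n) {i} (S : Subset n) → i ∉ S → ∣ S ∣ ≤ 1 →
  (∀ q → (∀ j → j ∈ₛ S → q · column G j ≡ false) → q · column G i ≡ false) →
  column G i ≢ p0 → ∃ λ j → j ≢ i × column G j ≡ column G i
recoverable⇒twin G {i} S i∉S ∣S∣≤1 recover ci≢0 with nonempty? S
... | no S≡∅ with separating (column G i) p0 ci≢0 ci≢0
...   | q , qci , _ = contradiction (trans (sym qci) (recover q λ j j∈S → ⊥-elim (S≡∅ (j , j∈S)))) λ ()
recoverable⇒twin G {i} S i∉S ∣S∣≤1 recover ci≢0 | yes (j , j∈S) with column G j ≟ₚ column G i
... | yes cj≡ci = j , (λ { refl → i∉S j∈S }) , cj≡ci
... | no cj≢ci with separating (column G i) (column G j) ci≢0 (cj≢ci ∘ sym)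
...   | q , qci , qcj = contradiction (trans (sym qci) (recover q λ k k∈S →
          subst (λ k → q · column G k ≡ false) (sym (∣S∣≤1-unique ∣S∣≤1 j∈S k∈S)) qcj)) λ ()

locality⇒noLoneColumns : ∀ {n} (G : GenMatrix 3 n) → HasLocality G 1 → NoLoneColumns (multiplicity G)
locality⇒noLoneColumns G loc = tabulate-nonzero λ v v≢0 m≡1 →
  let i , v≡ci = count-pos (λ j → v ≟ₚ column G j) (λ m≡0 → 0≢1+n (trans (sym m≡0) m≡1))
      S , i∉S , ∣S∣≤1 , recover = loc i
      j , j≢i , cj≡ci = recoverable⇒twin G S i∉S ∣S∣≤1 (λ q → recover (word q) zeroWord)
                          (λ ci≡0 → v≢0 (trans v≡ci ci≡0))
  in 1+n≰n (subst (2 ≤_) m≡1 (count≥2 (λ j → v ≟ₚ column G j) (j≢i ∘ sym) v≡ci (trans v≡ci (sym cj≡ci))))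

noLoneColumns⇒locality : ∀ {n} (G : GenMatrix 3 n) → NoLoneColumns (multiplicity G) → HasLocality G 1
noLoneColumns⇒locality {n} G noLone i with column G i ≟ₚ p0
... | yes ci≡0 = ⊥ₛ , ∉⊥ , subst (_≤ 1) (sym (∣⊥∣≡0 n)) z≤n , λ m m′ _ →
        trans (·-p0 m) (sym (·-p0 m′))
  where
  ·-p0 : ∀ m → message m · column G i ≡ false
  ·-p0 m = trans (cong (message m ·_) ci≡0) (·-zeroʳ (message m))
... | no ci≢0 with count-other (λ j → column G i ≟ₚ column G j) refl (lookup-nonzero noLone ci≢0)
...   | j , j≢i , ci≡cj = ⁅ j ⁆ , x≢y⇒x∉⁅y⁆ (j≢i ∘ sym) , ≤-reflexive (∣⁅x⁆∣≡1 j) , λ m m′ agree →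
        trans (cong (message m ·_) ci≡cj) (trans (agree j (x∈⁅x⁆ j)) (cong (message m′ ·_) (sym ci≡cj)))

matrixOf : (L : List Point) → GenMatrix 3 (length L)
matrixOf L i j = word (List.lookup L j) i

multiplicity-++ : ∀ L L′ v →
  multiplicity (matrixOf (L ++ L′)) v ≡ multiplicity (matrixOf L) v + multiplicity (matrixOf L′) v
multiplicity-++ [] L′ v = refl
multiplicity-++ (u ∷ L) L′ v =
  trans (cong (ind ⌊ v ≟ₚ u ⌋ +_) (multiplicity-++ L L′ v)) (sym (+-assoc (ind ⌊ v ≟ₚ u ⌋) _ _))

multiplicity-replicate : ∀ k u v → multiplicity (matrixOf (replicate k u)) v ≡ k * ind ⌊ v ≟ₚ u ⌋
multiplicity-replicate zero u v = refl
multiplicity-replicate (suc k) u v = cong (ind ⌊ v ≟ₚ u ⌋ +_) (multiplicity-replicate k u v)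

≟ₚ-sym : ∀ u v → ⌊ u ≟ₚ v ⌋ ≡ ⌊ v ≟ₚ u ⌋
≟ₚ-sym u v with u ≟ₚ v | v ≟ₚ u
... | yes _   | yes _   = refl
... | no _    | no _    = refl
... | yes u≡v | no v≢u  = ⊥-elim (v≢u (sym u≡v))
... | no u≢v  | yes v≡u = ⊥-elim (u≢v (sym v≡u))

columnsOf : (Point → ℕ) → List Point
columnsOf m = concatMap (λ u → replicate (m u) u) points

multiplicity-columnsOf : ∀ m v → multiplicity (matrixOf (columnsOf m)) v ≡ m v
multiplicity-columnsOf m v = begin
  multiplicity (matrixOf (columnsOf m)) v      ≡⟨ multiplicity-concat points ⟩
  Σₚ (λ u → m u * ind ⌊ v ≟ₚ u ⌋)
    ≡⟨ sum-map-cong (λ u → m u * ind ⌊ v ≟ₚ u ⌋) (λ u → ind ⌊ u ≟ₚ v ⌋ * m u)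
         (λ u → trans (*-comm (m u) (ind ⌊ v ≟ₚ u ⌋)) (cong (λ b → ind b * m u) (≟ₚ-sym v u))) points ⟩
  Σₚ (λ u → ind ⌊ u ≟ₚ v ⌋ * m u)
    ≡⟨ Σₚ-point v m ⟩
  m v ∎
  where
  open ≡-Reasoning
  multiplicity-concat : ∀ us → multiplicity (matrixOf (concatMap (λ u → replicate (m u) u) us)) v
                              ≡ sum (map (λ u → m u * ind ⌊ v ≟ₚ u ⌋) us)
  multiplicity-concat [] = refl
  multiplicity-concat (u ∷ us) = trans (multiplicity-++ (replicate (m u) u) _ v)
                                       (cong₂ _+_ (multiplicity-replicate (m u) u v) (multiplicity-concat us))

localCode : ∀ {d} (m : Point → ℕ) → 1 ≤ d → Distance d m → NoLoneColumns m → ExistsLocalCode (Σₚ m) 3 d 1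
localCode {d} m 1≤d dist noLone = subst (λ n → ExistsLocalCode n 3 d 1) length≡Σₚ
  (G , proj₁ code , proj₂ code , noLoneColumns⇒locality G noLone′)
  where
  G = matrixOf (columnsOf m)
  m≗ = multiplicity-columnsOf m
  code = distance⇒code G 1≤d (All.map (λ {q} → subst (d ≤_) (sym (weight-cong q m≗))) dist)
  noLone′ = All.map (λ {v} mv≢1 → mv≢1 ∘ trans (sym (m≗ v))) noLone
  length≡Σₚ : length (columnsOf m) ≡ Σₚ m
  length≡Σₚ = trans (length≡Σₚ-multiplicity G) (sum-map-cong _ _ m≗ points)

-- Small distances by exhaustive search

allUpTo : ℕ → (ℕ → Bool) → Bool
allUpTo zero f = f zero
allUpTo (suc B) f = f (suc B) ∧ allUpTo B f

allUpTo-sound : ∀ B {f k} → T (allUpTo B f) → k ≤ B → T (f k)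
allUpTo-sound zero t z≤n = t
allUpTo-sound (suc B) t k≤ with m≤n⇒m<n∨m≡n k≤
... | inj₂ refl = proj₁ (Equivalence.to T-∧ t)
... | inj₁ (s≤s k≤B) = allUpTo-sound B (proj₂ (Equivalence.to T-∧ t)) k≤B

forAllCounts : ℕ → ℕ → (List ℕ → Bool) → Bool
forAllCounts zero B P = P []
forAllCounts (suc k) B P = allUpTo B λ x → (x ≡ᵇ 1) ∨ forAllCounts k (B ∸ x) (P ∘ (x ∷_))

forAllCounts-sound : ∀ xs {B P} → T (forAllCounts (length xs) B P) → All (_≢ 1) xs → sum xs ≤ B → T (P xs)
forAllCounts-sound [] t [] _ = t
forAllCounts-sound (x ∷ xs) {B} t (x≢1 ∷ xs≢1) x+xs≤B with allUpTo-sound B t (m+n≤o⇒m≤o x x+xs≤B)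
... | t′ with x ≡ᵇ 1 in x≡ᵇ1
...   | true = ⊥-elim (x≢1 (≡ᵇ⇒≡ x 1 (subst T (sym x≡ᵇ1) _)))
...   | false =
  forAllCounts-sound xs t′ xs≢1 (m+n≤o⇒m≤o∸n (sum xs) (subst (_≤ B) (+-comm x (sum xs)) x+xs≤B))

fromCounts : List ℕ → Point → ℕ
fromCounts (c ∷ _) p1 = c
fromCounts (_ ∷ c ∷ _) p2 = c
fromCounts (_ ∷ _ ∷ c ∷ _) p3 = c
fromCounts (_ ∷ _ ∷ _ ∷ c ∷ _) p4 = c
fromCounts (_ ∷ _ ∷ _ ∷ _ ∷ c ∷ _) p5 = c
fromCounts (_ ∷ _ ∷ _ ∷ _ ∷ _ ∷ c ∷ _) p6 = c
fromCounts (_ ∷ _ ∷ _ ∷ _ ∷ _ ∷ _ ∷ c ∷ _) p7 = c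
fromCounts _ _ = 0

noLocalCode≤ : ℕ → ℕ → Bool
noLocalCode≤ B d = forAllCounts 7 B λ xs → ⌊ ¬? (distance? d (fromCounts xs)) ⌋

-- fromCounts (map m nonzeroPoints) agrees with m at every nonzero point by computation, so
-- Distance d of it is definitionally Distance d m.
noLocalCode≤-sound : ∀ {B d n} → T (noLocalCode≤ B d) → ExistsLocalCode n 3 d 1 → B < n
noLocalCode≤-sound {B} {d} t (G , dim , minDist , loc) = ≰⇒> λ n≤B →
  toWitness (forAllCounts-sound (map m nonzeroPoints) {P = λ xs → ⌊ ¬? (distance? d (fromCounts xs)) ⌋} t
                                (All.map⁺ (locality⇒noLoneColumns G loc))
                                (≤-trans (m≤n+m _ (m p0)) (subst (_≤ B) (length≡Σₚ-multiplicity G) n≤B)))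
            (code⇒distance G dim minDist)
  where m = multiplicity G

n₂loc≡-by-search : ∀ B d xs {_ : True (1 ≤? d)} {_ : True (distance? d (fromCounts xs))}
  {_ : True (noLoneColumns? (fromCounts xs))} {_ : T (noLocalCode≤ B d)} →
  Σₚ (fromCounts xs) ≡ suc B → n₂loc≡ 3 d 1 (suc B)
n₂loc≡-by-search B d xs {1≤d} {dist} {noLone} {none} Σ≡ =
  subst (λ n → ExistsLocalCode n 3 d 1) Σ≡
    (localCode (fromCounts xs) (toWitness 1≤d) (toWitness dist) (toWitness noLone)) ,
  λ _ → noLocalCode≤-sound none

-- The Griesmer bound

-- d + ⌈d/2⌉ + ⌈d/4⌉, written using ⌈d/4⌉ = ⌈⌈d/2⌉/2⌉.
griesmer₃ : ℕ → ℕ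
griesmer₃ d = d + (⌈ d /2⌉ + ⌈ ⌈ d /2⌉ /2⌉)

⌈/2⌉-least : ∀ {d a} → d ≤ a + a → ⌈ d /2⌉ ≤ a
⌈/2⌉-least {a = a} d≤2a = ≤-trans (⌈n/2⌉-mono d≤2a) (≤-reflexive (sym (n≡⌈n+n/2⌉ a)))

+-⌈/2⌉ : ∀ m n → m + ⌈ n /2⌉ ≡ ⌈ (m + m) + n /2⌉
+-⌈/2⌉ zero n = refl
+-⌈/2⌉ (suc m) n = trans (cong suc (+-⌈/2⌉ m n)) (cong (λ k → ⌈ suc k + n /2⌉) (sym (+-suc m m)))

⌈3/2⌉-least : ∀ {h N} → h + (h + h) ≤ N + N → h + ⌈ h /2⌉ ≤ N
⌈3/2⌉-least {h} {N} 3h≤2N = begin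
  h + ⌈ h /2⌉       ≡⟨ +-⌈/2⌉ h h ⟩
  ⌈ (h + h) + h /2⌉ ≤⟨ ⌈/2⌉-least (≤-trans (≤-reflexive (+-comm (h + h) h)) 3h≤2N) ⟩
  N                 ∎
  where open ≤-Reasoning

residual : Point → Point → (Point → ℕ) → ℕ
residual q q′ m = Σ⁺ (λ v → if not (q · v) ∧ q′ · v then m v else 0)

offSupport : Point → (Point → ℕ) → ℕ
offSupport q m = Σ⁺ (λ v → if q · v then 0 else m v)

Σ⁺-split : ∀ q m → Σ⁺ m ≡ weight q m + offSupport q m
Σ⁺-split q m =
  trans (sum-map-cong m _ (λ v → split (q · v) (m v)) nonzeroPoints)
        (sum-map-+ (λ v → if q · v then m v else 0) (λ v → if q · v then 0 else m v) nonzeroPoints)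
  where
  split : ∀ b k → k ≡ (if b then k else 0) + (if b then 0 else k)
  split true k = sym (+-identityʳ k)
  split false k = refl

weight-⊕ : ∀ q q′ m → weight q′ m + weight (q ⊕ q′) m ≡ weight q m + (residual q q′ m + residual q q′ m)
weight-⊕ q q′ m = begin
  weight q′ m + weight (q ⊕ q′) m
    ≡⟨ sym (sum-map-+ (w q′) (w (q ⊕ q′)) nonzeroPoints) ⟩
  Σ⁺ (λ v → w q′ v + w (q ⊕ q′) v)
    ≡⟨ sum-map-cong _ (λ v → w q v + (r v + r v)) pointwise nonzeroPoints ⟩
  Σ⁺ (λ v → w q v + (r v + r v))
    ≡⟨ sum-map-+ (w q) (λ v → r v + r v) nonzeroPoints ⟩
  weight q m + Σ⁺ (λ v → r v + r v)
    ≡⟨ cong (weight q m +_) (sum-map-+ r r nonzeroPoints) ⟩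
  weight q m + (residual q q′ m + residual q q′ m) ∎
  where
  open ≡-Reasoning
  w : Point → Point → ℕ
  w q v = if q · v then m v else 0
  r : Point → ℕ
  r v = if not (q · v) ∧ q′ · v then m v else 0
  bool : ∀ a b k → (if b then k else 0) + (if a xor b then k else 0)
                 ≡ (if a then k else 0) + ((if not a ∧ b then k else 0) + (if not a ∧ b then k else 0))
  bool true true k = refl
  bool true false k = sym (+-identityʳ k)
  bool false true k = refl
  bool false false k = refl
  pointwise : ∀ v → w q′ v + w (q ⊕ q′) v ≡ w q v + (r v + r v)
  pointwise v = trans (cong (λ b → w q′ v + (if b then m v else 0)) (·-distribʳ-⊕ q q′ v))
                      (bool (q · v) (q′ · v) (m v))

residuals≤ : ∀ q r s m →
  residual q r m + (residual q s m + residual q (r ⊕ s) m) ≤ offSupport q m + offSupport q m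
residuals≤ q r s m = begin
  residual q r m + (residual q s m + residual q (r ⊕ s) m)
    ≡⟨ cong (residual q r m +_) (sym (sum-map-+ (res s) (res (r ⊕ s)) nonzeroPoints)) ⟩
  residual q r m + Σ⁺ (λ v → res s v + res (r ⊕ s) v)
    ≡⟨ sym (sum-map-+ (res r) (λ v → res s v + res (r ⊕ s) v) nonzeroPoints) ⟩
  Σ⁺ (λ v → res r v + (res s v + res (r ⊕ s) v))
    ≤⟨ sum-map-mono-≤ pointwise nonzeroPoints ⟩
  Σ⁺ (λ v → off v + off v)
    ≡⟨ sum-map-+ off off nonzeroPoints ⟩
  offSupport q m + offSupport q m ∎
  where
  open ≤-Reasoning
  res : Point → Point → ℕ
  res q′ v = if not (q · v) ∧ q′ · v then m v else 0
  off : Point → ℕ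
  off v = if q · v then 0 else m v
  bool : ∀ a b c k →
    (if not a ∧ b then k else 0) + ((if not a ∧ c then k else 0) + (if not a ∧ (b xor c) then k else 0))
      ≤ (if a then 0 else k) + (if a then 0 else k)
  bool true b c k = z≤n
  bool false true true k = ≤-reflexive (cong (k +_) (+-identityʳ k))
  bool false true false k = ≤-refl
  bool false false true k = ≤-refl
  bool false false false k = z≤n
  pointwise : ∀ v → res r v + (res s v + res (r ⊕ s) v) ≤ off v + off v
  pointwise v = subst (λ b → res r v + (res s v + (if not (q · v) ∧ b then m v else 0)) ≤ off v + off v)
                      (sym (·-distribʳ-⊕ r s v)) (bool (q · v) (r · v) (s · v) (m v))

weight≤2residual : ∀ q₀ q m → weight q₀ m ≤ weight (q₀ ⊕ q) m →
  weight q m ≤ residual q₀ q m + residual q₀ q m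
weight≤2residual q₀ q m q₀≤q₀⊕q = +-cancelʳ-≤ (weight q₀ m) (weight q m) (r + r) (begin
  weight q m + weight q₀ m       ≤⟨ +-monoʳ-≤ (weight q m) q₀≤q₀⊕q ⟩
  weight q m + weight (q₀ ⊕ q) m ≡⟨ weight-⊕ q₀ q m ⟩
  weight q₀ m + (r + r)          ≡⟨ +-comm (weight q₀ m) (r + r) ⟩
  (r + r) + weight q₀ m          ∎)
  where
  open ≤-Reasoning
  r = residual q₀ q m

Outside : Point → Point → Set
Outside q q′ = q′ ≢ p0 × q′ ≢ q

basis-extension : ∀ {q} → q ≢ p0 → Σ Point λ r → Σ Point λ s → Outside q r × Outside q s × Outside q (r ⊕ s)
basis-extension {p0} q≢0 = ⊥-elim (q≢0 refl)
basis-extension {p1} _ = p2 , p4 , ((λ ()) , (λ ())) , ((λ ()) , (λ ())) , ((λ ()) , (λ ()))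
basis-extension {p2} _ = p1 , p4 , ((λ ()) , (λ ())) , ((λ ()) , (λ ())) , ((λ ()) , (λ ()))
basis-extension {p3} _ = p1 , p4 , ((λ ()) , (λ ())) , ((λ ()) , (λ ())) , ((λ ()) , (λ ()))
basis-extension {p4} _ = p1 , p2 , ((λ ()) , (λ ())) , ((λ ()) , (λ ())) , ((λ ()) , (λ ()))
basis-extension {p5} _ = p1 , p2 , ((λ ()) , (λ ())) , ((λ ()) , (λ ())) , ((λ ()) , (λ ()))
basis-extension {p6} _ = p1 , p2 , ((λ ()) , (λ ())) , ((λ ()) , (λ ())) , ((λ ()) , (λ ()))
basis-extension {p7} _ = p1 , p2 , ((λ ()) , (λ ())) , ((λ ()) , (λ ())) , ((λ ()) , (λ ()))

minimum-weight : ∀ m → Σ Point λ q₀ → q₀ ≢ p0 × (∀ {q} → q ≢ p0 → weight q₀ m ≤ weight q m)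
minimum-weight m =
  q₀ , argmin-all (λ q → weight q m) (λ ()) (tabulate-nonzero λ _ q≢0 → q≢0) ,
  lookup-nonzero (f[argmin]≤f[xs] {f = λ q → weight q m} p1 nonzeroPoints)
  where q₀ = argmin (λ q → weight q m) p1 nonzeroPoints

-- The residual code off the support of a minimum-weight codeword q₀ has distance at least ⌈d/2⌉.
griesmer-bound-from-minimum : ∀ {d} m q₀ → q₀ ≢ p0 → (∀ {q} → q ≢ p0 → weight q₀ m ≤ weight q m) →
  Distance d m → griesmer₃ d ≤ Σ⁺ m
griesmer-bound-from-minimum {d} m q₀ q₀≢0 minimal dist = begin
  d + (h + ⌈ h /2⌉)
    ≤⟨ +-mono-≤ (lookup-nonzero dist q₀≢0) (⌈3/2⌉-least {h} {offSupport q₀ m} 3h≤2off) ⟩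
  weight q₀ m + offSupport q₀ m
    ≡⟨ sym (Σ⁺-split q₀ m) ⟩
  Σ⁺ m ∎
  where
  open ≤-Reasoning
  h = ⌈ d /2⌉
  half : ∀ {q} → Outside q₀ q → h ≤ residual q₀ q m
  half {q} (q≢0 , q≢q₀) = ⌈/2⌉-least (≤-trans (lookup-nonzero dist q≢0)
    (weight≤2residual q₀ q m (minimal (q≢q₀ ∘ sym ∘ ⊕≡p0⇒≡ q₀ q))))
  3h≤2off : h + (h + h) ≤ offSupport q₀ m + offSupport q₀ m
  3h≤2off with basis-extension q₀≢0
  ... | r , s , r-out , s-out , rs-out =
    ≤-trans (+-mono-≤ (half r-out) (+-mono-≤ (half s-out) (half rs-out))) (residuals≤ q₀ r s m)

griesmer-bound-multiplicities : ∀ {d} m → Distance d m → griesmer₃ d ≤ Σ⁺ m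
griesmer-bound-multiplicities m =
  let q₀ , q₀≢0 , minimal = minimum-weight m in griesmer-bound-from-minimum m q₀ q₀≢0 minimal

griesmer-bound : ∀ {n d} → ExistsCode n 3 d → griesmer₃ d ≤ n
griesmer-bound (G , dim , minDist) =
  ≤-trans (griesmer-bound-multiplicities (multiplicity G) (code⇒distance G dim minDist))
          (≤-trans (m≤n+m _ (multiplicity G p0)) (≤-reflexive (sym (length≡Σₚ-multiplicity G))))

-- Local codes attaining the Griesmer bound

AtLeastTwice : (Point → ℕ) → Set
AtLeastTwice m = All (λ v → 2 ≤ m v) nonzeroPoints

atLeastTwice? : ∀ m → Dec (AtLeastTwice m)
atLeastTwice? m = all? (λ v → 2 ≤? m v) nonzeroPoints

atLeastTwice⇒noLoneColumns : ∀ {m} → AtLeastTwice m → NoLoneColumns m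
atLeastTwice⇒noLoneColumns = All.map λ 2≤mv mv≡1 → 1+n≰n (subst (2 ≤_) mv≡1 2≤mv)

simplex : Point → ℕ
simplex p0 = 0
simplex _ = 1

weight-simplex : ∀ {q} → q ≢ p0 → weight q simplex ≡ 4
weight-simplex = lookup-nonzero {P = λ q → weight q simplex ≡ 4}
  (refl ∷ refl ∷ refl ∷ refl ∷ refl ∷ refl ∷ refl ∷ [])

griesmer₃-+4 : ∀ d → griesmer₃ (4 + d) ≡ 7 + griesmer₃ d
griesmer₃-+4 d = shift d ⌈ d /2⌉ ⌈ ⌈ d /2⌉ /2⌉
  where
  shift : ∀ d h k → 4 + (d + ((2 + h) + (1 + k))) ≡ 7 + (d + (h + k))
  shift = solve-∀

LocalGriesmer : ℕ → (Point → ℕ) → Set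
LocalGriesmer d m = Σₚ m ≡ griesmer₃ d × Distance d m × AtLeastTwice m

localGriesmer? : ∀ d m → Dec (LocalGriesmer d m)
localGriesmer? d m = (Σₚ m ≟ griesmer₃ d) ×-dec distance? d m ×-dec atLeastTwice? m

localGriesmer-+4 : ∀ {d m} → LocalGriesmer d m → LocalGriesmer (4 + d) (λ v → simplex v + m v)
localGriesmer-+4 {d} {m} (Σ≡ , dist , twice) =
  trans (sum-map-+ simplex m points) (trans (cong (7 +_) Σ≡) (sym (griesmer₃-+4 d))) ,
  tabulate-nonzero (λ q q≢0 → subst (4 + d ≤_)
    (sym (trans (weight-+ q simplex m) (cong (_+ weight q m) (weight-simplex q≢0))))
    (+-monoʳ-≤ 4 (lookup-nonzero dist q≢0))) ,
  All.map (λ {v} 2≤mv → ≤-trans 2≤mv (m≤n+m (m v) (simplex v))) twice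

localGriesmer-≥8 : ∀ e → ∃ (LocalGriesmer (8 + e))
localGriesmer-≥8 0 = _ , from-yes (localGriesmer? 8 (fromCounts (2 ∷ 2 ∷ 2 ∷ 2 ∷ 2 ∷ 2 ∷ 2 ∷ [])))
localGriesmer-≥8 1 = _ , from-yes (localGriesmer? 9 (fromCounts (2 ∷ 2 ∷ 2 ∷ 2 ∷ 3 ∷ 3 ∷ 3 ∷ [])))
localGriesmer-≥8 2 = _ , from-yes (localGriesmer? 10 (fromCounts (2 ∷ 2 ∷ 2 ∷ 3 ∷ 3 ∷ 3 ∷ 3 ∷ [])))
localGriesmer-≥8 3 = _ , from-yes (localGriesmer? 11 (fromCounts (2 ∷ 3 ∷ 3 ∷ 3 ∷ 3 ∷ 3 ∷ 3 ∷ [])))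
localGriesmer-≥8 (suc (suc (suc (suc e)))) = _ , localGriesmer-+4 (proj₂ (localGriesmer-≥8 e))

griesmerLocalCode : ∀ {d} → 8 ≤ d → ExistsLocalCode (griesmer₃ d) 3 d 1
griesmerLocalCode 8≤d with m≤n⇒∃[o]m+o≡n 8≤d
... | e , refl =
  let m , Σ≡ , dist , twice = localGriesmer-≥8 e
  in subst (λ n → ExistsLocalCode n 3 (8 + e) 1) Σ≡
       (localCode m (s≤s z≤n) dist (atLeastTwice⇒noLoneColumns twice))

IsMinimum-⇔ : ∀ {P Q : ℕ → Set} {m} → (∀ {k} → P k → Q k) → P m → (∀ k → Q k → m ≤ k) →
  ∀ n → IsMinimum P n ⇔ IsMinimum Q n
IsMinimum-⇔ {P} P⇒Q Pm Q≥m n = mk⇔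
  (λ (Pn , P≥n) → P⇒Q Pn , λ k Qk → ≤-trans (P≥n _ Pm) (Q≥m k Qk))
  (λ (Qn , Q≥n) → subst P (≤-antisym (Q≥m n Qn) (Q≥n _ (P⇒Q Pm))) Pm , λ k Pk → Q≥n k (P⇒Q Pk))

forgetLocality : ∀ {n k d r} → ExistsLocalCode n k d r → ExistsCode n k d
forgetLocality (G , dim , dist , _) = G , dim , dist

theorem36 : n₂loc≡ 3 1 1 6 × n₂loc≡ 3 2 1 6 × n₂loc≡ 3 3 1 8 × n₂loc≡ 3 4 1 8
    × n₂loc≡ 3 5 1 11 × n₂loc≡ 3 6 1 12 × n₂loc≡ 3 7 1 14
    × (∀ (d : ℕ) → 8 ≤ d → ∀ (n : ℕ) → (n₂loc≡ 3 d 1 n ⇔ n₂≡ 3 d n))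
theorem36 =
  n₂loc≡-by-search 5 1 (0 ∷ 0 ∷ 0 ∷ 0 ∷ 2 ∷ 2 ∷ 2 ∷ []) refl ,
  n₂loc≡-by-search 5 2 (0 ∷ 0 ∷ 0 ∷ 0 ∷ 2 ∷ 2 ∷ 2 ∷ []) refl ,
  n₂loc≡-by-search 7 3 (0 ∷ 0 ∷ 0 ∷ 2 ∷ 2 ∷ 2 ∷ 2 ∷ []) refl ,
  n₂loc≡-by-search 7 4 (0 ∷ 0 ∷ 0 ∷ 2 ∷ 2 ∷ 2 ∷ 2 ∷ []) refl ,
  n₂loc≡-by-search 10 5 (0 ∷ 0 ∷ 0 ∷ 2 ∷ 3 ∷ 3 ∷ 3 ∷ []) refl ,
  n₂loc≡-by-search 11 6 (0 ∷ 0 ∷ 0 ∷ 3 ∷ 3 ∷ 3 ∷ 3 ∷ []) refl ,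
  n₂loc≡-by-search 13 7 (0 ∷ 2 ∷ 2 ∷ 2 ∷ 2 ∷ 3 ∷ 3 ∷ []) refl ,
  λ d 8≤d → IsMinimum-⇔ forgetLocality (griesmerLocalCode 8≤d) (λ _ → griesmer-bound)
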